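{- Let $n$ be a positive integer. A connected graph is $n$-monophilic if and only if its core is $n$-monophilic.
   Context: All graphs are finite and simple. The core of a connected graph $G$ is the subgraph obtained by repeatedly deleting vertices of degree $1$ until every remaining vertex has degree at least $2$ (or a single vertex remains). An $n$-list assignment for $G$ assigns to each vertex $v$ a set $L(v)\subseteq\mathbb{N}$ with $|L(v)|=n$. A coloring of $G$ from $L$ is a map $\gamma$ with $\gamma(v)\in L(v)$ and $\gamma(v)\neq\gamma(w)$ for adjacent $v,w$; $\mathrm{col}(G,L)$ is the number of such colorings, and $\mathrm{col}(G,n)$ is $\mathrm{col}(G,L)$ for $L(v)=\{1,\dots,n\}$ for all $v$. $G$ is $n$-monophilic if $\mathrm{col}(G,n)\le\mathrm{col}(G,L)$ for every $n$-list assignment $L$. -}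

module Defs where

open import Data.Nat using (ℕ; zero; suc; _+_; _≤_; _≡ᵇ_)
open import Data.Bool using (Bool; true; false; not; _∨_; if_then_else_)
open import Data.Fin using (Fin; toℕ; punchIn)
open import Data.List using (List; []; _∷_; map; concatMap; allFin; length; filterᵇ)
open import Data.Nat.ListAction using (sum)
open import Data.Bool.ListAction using (all)
open import Data.Product using (_×_)
open import Data.Sum using (_⊎_)
open import Relation.Binary.PropositionalEquality using (_≡_)

record Graph (m : ℕ) : Set where
  field
    adj    : Fin m → Fin m → Bool
    sym    : ∀ u v → adj u v ≡ adj v u
    irrefl : ∀ v → adj v v ≡ false
open Graph public

degree : ∀ {m} → Graph m → Fin m → ℕ
degree {m} G v = sum (map (λ w → if adj G v w then 1 else 0) (allFin m))

data Reach {m : ℕ} (G : Graph m) : Fin m → Fin m → Set where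
  here : ∀ {u} → Reach G u u
  step : ∀ {u w v} → adj G u w ≡ true → Reach G w v → Reach G u v

Connected : ∀ {m} → Graph m → Set
Connected {m} G = (1 ≤ m) × (∀ u v → Reach G u v)

deleteVertex : ∀ {m} → Graph (suc m) → Fin (suc m) → Graph m
deleteVertex G v = record
  { adj    = λ i j → adj G (punchIn v i) (punchIn v j)
  ; sym    = λ i j → sym G (punchIn v i) (punchIn v j)
  ; irrefl = λ i → irrefl G (punchIn v i)
  }

data LeafReduces : ∀ {m k} → Graph m → Graph k → Set where
  done : ∀ {m} {G : Graph m} → LeafReduces G G
  del  : ∀ {m k} {G : Graph (suc m)} {H : Graph k} (v : Fin (suc m)) →
         degree G v ≡ 1 → LeafReduces (deleteVertex G v) H → LeafReduces G H

CoreStop : ∀ {k} → Graph k → Set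
CoreStop {k} H = (k ≡ 1) ⊎ (∀ v → 2 ≤ degree H v)

IsCoreOf : ∀ {m k} → Graph k → Graph m → Set
IsCoreOf H G = LeafReduces G H × CoreStop H

-- An n-list assignment: L v i is the i-th element of L(v), and the
-- n elements of L(v) are pairwise distinct (so |L(v)| = n).
ListAssignment : ℕ → ℕ → Set
ListAssignment m n = Fin m → Fin n → ℕ

IsListAssignment : ∀ {m n} → ListAssignment m n → Set
IsListAssignment {m} {n} L = ∀ v (i j : Fin n) → L v i ≡ L v j → i ≡ j

choices : (m n : ℕ) → List (Fin m → Fin n)
choices zero    n = (λ ()) ∷ []
choices (suc m) n = concatMap (λ i → map (λ f → extend i f) (choices m n)) (allFin n)
  where
  extend : Fin n → (Fin m → Fin n) → Fin (suc m) → Fin n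
  extend i f Fin.zero    = i
  extend i f (Fin.suc x) = f x

properB : ∀ {m} → Graph m → (Fin m → ℕ) → Bool
properB {m} G c =
  all (λ u → all (λ w → not (adj G u w) ∨ not (c u ≡ᵇ c w)) (allFin m)) (allFin m)

-- col(G,L): colourings γ with γ(v) ∈ L(v) correspond bijectively to
-- choices f of an index f v with γ(v) = L v (f v) (the entries are distinct).
col : ∀ {m n} → Graph m → ListAssignment m n → ℕ
col {m} {n} G L = length (filterᵇ (λ f → properB G (λ v → L v (f v))) (choices m n))

standard : ∀ {m} n → ListAssignment m n
standard n v i = suc (toℕ i)

colN : ∀ {m} → Graph m → ℕ → ℕ
colN G n = col G (standard n)

Monophilic : ∀ {m} → ℕ → Graph m → Set
Monophilic {m} n G = ∀ (L : ListAssignment m n) → IsListAssignment L → colN G n ≤ col G L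

-- Let v be a leaf of G with neighbour u. A colouring of G from L is a colouring of G - v from L
-- together with a colour in L(v) other than the colour of u; since |L(v)| = n there are at least
-- n - 1 such colours, and exactly n - 1 when L(v) = L(u). So deleting a leaf multiplies col(G, n)
-- by exactly n - 1 and col(G, L) by at least n - 1, and for n ≥ 2 monophily transfers in both
-- directions, extending a list assignment of G - v to G by L(v) := L(u). Every graph is
-- 1-monophilic.
module Submission where

open import Defs renaming (sym to adj-sym)
open import Data.Nat using (ℕ; zero; suc; _+_; _*_; _≤_; z≤n; s≤s; _≡ᵇ_)
open import Data.Nat.Properties as ℕ
  using (+-identityʳ; +-mono-≤; *-distribʳ-+; *-monoʳ-≤; *-cancelʳ-≤; m≤n+m;
         +-commutativeSemigroup)
open import Data.Nat.ListAction using (sum)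
open import Data.Nat.ListAction.Properties using (sum-++)
open import Data.Bool using (Bool; true; false; not; _∧_; _∨_; if_then_else_; T)
open import Data.Bool.ListAction using (all)
open import Data.Bool.Properties using (T-∧)
open import Data.Fin using (Fin; zero; suc; toℕ; punchIn; punchOut; _≟_)
import Data.Fin.Properties as Fin
open import Data.List using (List; []; _∷_; map; concatMap; allFin; length; filterᵇ; _++_)
open import Data.List.Properties using (map-cong; map-∘; map-++; map-tabulate)
open import Data.List.Membership.Propositional using (_∈_)
open import Data.List.Membership.Propositional.Properties using (∈-allFin)
open import Data.List.Relation.Unary.Any using (here; there)
open import Data.Vec.Functional using (insertAt; removeAt)
open import Data.Vec.Functional.Properties using (insertAt-lookup; insertAt-punchIn; removeAt-insertAt)
open import Data.Product using (∃-syntax; _×_; _,_; proj₁; proj₂)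
open import Data.Empty using (⊥-elim)
open import Data.Unit using (tt)
open import Function using (_∘_; id)
open import Function.Bundles using (_⇔_; mk⇔; Equivalence)
open import Function.Construct.Identity using (⇔-id)
open import Function.Construct.Composition using (_⇔-∘_)
open import Relation.Nullary using (¬_; yes; no)
open import Relation.Nullary.Decidable using (dec-true; dec-false)
open import Relation.Binary.PropositionalEquality
open import Algebra.Properties.CommutativeSemigroup +-commutativeSemigroup using (interchange)

private variable
  A B : Set
  m n : ℕ

-- Finite sums

∑ : List A → (A → ℕ) → ℕ
∑ xs f = sum (map f xs)

infix 5 ∑
syntax ∑ xs (λ x → e) = ∑[ x ∈ xs ] e

∑-cong : {f g : A → ℕ} → f ≗ g → (xs : List A) → ∑ xs f ≡ ∑ xs g
∑-cong f≗g xs = cong sum (map-cong f≗g xs)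

∑-mono : {f g : A → ℕ} → (∀ x → f x ≤ g x) → (xs : List A) → ∑ xs f ≤ ∑ xs g
∑-mono f≤g []       = z≤n
∑-mono f≤g (x ∷ xs) = +-mono-≤ (f≤g x) (∑-mono f≤g xs)

∑-map : (g : A → B) (h : B → ℕ) (xs : List A) → ∑ (map g xs) h ≡ ∑[ x ∈ xs ] h (g x)
∑-map g h xs = cong sum (sym (map-∘ xs))

∑-++ : (xs ys : List A) (h : A → ℕ) → ∑ (xs ++ ys) h ≡ ∑ xs h + ∑ ys h
∑-++ xs ys h = trans (cong sum (map-++ h xs ys)) (sum-++ (map h xs) (map h ys))

∑-concatMap : (g : A → List B) (h : B → ℕ) (xs : List A) →
              ∑ (concatMap g xs) h ≡ ∑[ x ∈ xs ] ∑ (g x) h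
∑-concatMap g h []       = refl
∑-concatMap g h (x ∷ xs) = trans (∑-++ (g x) _ h) (cong (∑ (g x) h +_) (∑-concatMap g h xs))

∑-zero : (xs : List A) → ∑[ x ∈ xs ] 0 ≡ 0
∑-zero []       = refl
∑-zero (x ∷ xs) = ∑-zero xs

∑-+ : (f g : A → ℕ) (xs : List A) → ∑[ x ∈ xs ] (f x + g x) ≡ ∑ xs f + ∑ xs g
∑-+ f g []       = refl
∑-+ f g (x ∷ xs) = trans (cong (f x + g x +_) (∑-+ f g xs)) (interchange (f x) (g x) _ _)

∑-*ʳ : (f : A → ℕ) (c : ℕ) (xs : List A) → ∑[ x ∈ xs ] (f x * c) ≡ ∑ xs f * c
∑-*ʳ f c []       = refl
∑-*ʳ f c (x ∷ xs) = trans (cong (f x * c +_) (∑-*ʳ f c xs)) (sym (*-distribʳ-+ c (f x) _))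

∑-comm : (g : A → B → ℕ) (xs : List A) (ys : List B) →
         ∑[ x ∈ xs ] ∑ ys (g x) ≡ ∑[ y ∈ ys ] ∑[ x ∈ xs ] g x y
∑-comm g []       ys = sym (∑-zero ys)
∑-comm g (x ∷ xs) ys = trans (cong (∑ ys (g x) +_) (∑-comm g xs ys)) (sym (∑-+ (g x) _ ys))

∑-allFin-suc : (g : Fin (suc n) → ℕ) → ∑ (allFin (suc n)) g ≡ g zero + (∑[ i ∈ allFin n ] g (suc i))
∑-allFin-suc g =
  cong (g zero +_) (cong sum (trans (map-tabulate suc g) (sym (map-tabulate id (g ∘ suc)))))

𝟙 : Bool → ℕ
𝟙 b = if b then 1 else 0

length-filterᵇ : (p : A → Bool) (xs : List A) → length (filterᵇ p xs) ≡ ∑[ x ∈ xs ] 𝟙 (p x)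
length-filterᵇ p []       = refl
length-filterᵇ p (x ∷ xs) with p x
... | true  = cong suc (length-filterᵇ p xs)
... | false = length-filterᵇ p xs

𝟙-mono : {b c : Bool} → (T b → T c) → 𝟙 b ≤ 𝟙 c
𝟙-mono {false}        _   = z≤n
𝟙-mono {true} {true}  _   = s≤s z≤n
𝟙-mono {true} {false} b⇒c = ⊥-elim (b⇒c tt)

∑-𝟙-∧ : (q : Bool) (p : A → Bool) (xs : List A) → ∑[ x ∈ xs ] 𝟙 (q ∧ p x) ≡ 𝟙 q * (∑[ x ∈ xs ] 𝟙 (p x))
∑-𝟙-∧ true  p xs = sym (+-identityʳ _)
∑-𝟙-∧ false p xs = ∑-zero xs

∑𝟙≡0⇒¬T : (p : A → Bool) (xs : List A) → ∑[ x ∈ xs ] 𝟙 (p x) ≡ 0 → ∀ {x} → x ∈ xs → ¬ T (p x)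
∑𝟙≡0⇒¬T p (y ∷ xs) s x∈ t with p y in py
∑𝟙≡0⇒¬T p (y ∷ xs) s (here refl) t | false = subst T py t
∑𝟙≡0⇒¬T p (y ∷ xs) s (there x∈)  t | false = ∑𝟙≡0⇒¬T p xs s x∈ t

∑𝟙≡1⇒unique : (p : A → Bool) (xs : List A) → ∑[ x ∈ xs ] 𝟙 (p x) ≡ 1 →
              ∃[ x ] T (p x) × (∀ {y} → y ∈ xs → T (p y) → y ≡ x)
∑𝟙≡1⇒unique p (x ∷ xs) s with p x in px
... | true  = x , subst T (sym px) tt , unique
  where
  unique : ∀ {y} → y ∈ x ∷ xs → T (p y) → y ≡ x
  unique (here refl) _ = refl
  unique (there y∈)  t = ⊥-elim (∑𝟙≡0⇒¬T p xs (ℕ.suc-injective s) y∈ t)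
... | false with ∑𝟙≡1⇒unique p xs s
...   | w , pw , unique = w , pw , unique′
  where
  unique′ : ∀ {y} → y ∈ x ∷ xs → T (p y) → y ≡ w
  unique′ (here refl) t = ⊥-elim (subst T px t)
  unique′ (there y∈)  t = unique y∈ t

-- Colours of a list that avoid a given colour

≡ᵇ-refl : (x : ℕ) → (x ≡ᵇ x) ≡ true
≡ᵇ-refl x = dec-true (x ℕ.≟ x) refl

≢⇒≡ᵇ-false : {x y : ℕ} → x ≢ y → (x ≡ᵇ y) ≡ false
≢⇒≡ᵇ-false {x} {y} = dec-false (x ℕ.≟ y)

T-not-≡ᵇ : {x y : ℕ} → T (not (x ≡ᵇ y)) → x ≢ y
T-not-≡ᵇ {x} t refl rewrite ≡ᵇ-refl x = t

≢⇒T-not-≡ᵇ : {x y : ℕ} → x ≢ y → T (not (x ≡ᵇ y))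
≢⇒T-not-≡ᵇ x≢y rewrite ≢⇒≡ᵇ-false x≢y = tt

Injective : (Fin n → ℕ) → Set
Injective {n} a = (i j : Fin n) → a i ≡ a j → i ≡ j

count≢ : (Fin n → ℕ) → ℕ → ℕ
count≢ {n} a c = ∑[ i ∈ allFin n ] 𝟙 (not (a i ≡ᵇ c))

count≢-suc : (a : Fin (suc n) → ℕ) (c : ℕ) → count≢ a c ≡ 𝟙 (not (a zero ≡ᵇ c)) + count≢ (a ∘ suc) c
count≢-suc a c = ∑-allFin-suc (λ i → 𝟙 (not (a i ≡ᵇ c)))

count≢-all : (a : Fin n → ℕ) (c : ℕ) → (∀ i → a i ≢ c) → count≢ a c ≡ n
count≢-all {zero}  a c a≢c = refl
count≢-all {suc n} a c a≢c = trans (count≢-suc a c)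
  (cong₂ _+_ (cong (𝟙 ∘ not) (≢⇒≡ᵇ-false (a≢c zero))) (count≢-all (a ∘ suc) c (a≢c ∘ suc)))

Injective-suc : {a : Fin (suc n) → ℕ} → Injective a → Injective (a ∘ suc)
Injective-suc inj i j e = Fin.suc-injective (inj (suc i) (suc j) e)

count≢-≥ : (a : Fin (suc n) → ℕ) → Injective a → (c : ℕ) → n ≤ count≢ a c
count≢-≥ {zero}  a inj c = z≤n
count≢-≥ {suc n} a inj c rewrite count≢-suc a c with a zero ℕ.≟ c
... | yes refl = begin
  suc n                                                    ≡⟨ count≢-all (a ∘ suc) (a zero) a₁≢a₀ ⟨
  count≢ (a ∘ suc) (a zero)                                ≤⟨ m≤n+m _ (𝟙 (not (a zero ≡ᵇ a zero))) ⟩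
  𝟙 (not (a zero ≡ᵇ a zero)) + count≢ (a ∘ suc) (a zero)  ∎
  where
  open ℕ.≤-Reasoning
  a₁≢a₀ : ∀ i → a (suc i) ≢ a zero
  a₁≢a₀ i e = Fin.0≢1+n (sym (inj (suc i) zero e))
... | no a₀≢c rewrite ≢⇒≡ᵇ-false a₀≢c = s≤s (count≢-≥ (a ∘ suc) (Injective-suc inj) c)

count≢-image : (a : Fin (suc n) → ℕ) → Injective a → (j : Fin (suc n)) → count≢ a (a j) ≡ n
count≢-image a inj zero rewrite count≢-suc a (a zero) | ≡ᵇ-refl (a zero) =
  count≢-all (a ∘ suc) (a zero) (λ i e → Fin.0≢1+n (sym (inj (suc i) zero e)))
count≢-image {suc n} a inj (suc j) rewrite count≢-suc a (a (suc j))
                                         | ≢⇒≡ᵇ-false (Fin.0≢1+n ∘ inj zero (suc j)) =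
  cong suc (count≢-image (a ∘ suc) (Injective-suc inj) j)

-- Summing over choice functions

Extensional : ((Fin m → Fin n) → ℕ) → Set
Extensional h = ∀ {f g} → f ≗ g → h f ≡ h g

insertAt-cong : {f g : Fin m → A} (v : Fin (suc m)) (i : A) → f ≗ g → insertAt f v i ≗ insertAt g v i
insertAt-cong zero    i f≗g zero    = refl
insertAt-cong zero    i f≗g (suc x) = f≗g x
insertAt-cong {m = suc m} (suc v) i f≗g zero    = f≗g zero
insertAt-cong {m = suc m} (suc v) i f≗g (suc x) = insertAt-cong v i (f≗g ∘ suc) x

insertAt-preserves : (P : A → Set) {f : Fin m → A} {i : A} →
                     (∀ y → P (f y)) → P i → (v x : Fin (suc m)) → P (insertAt f v i x)
insertAt-preserves P Pf Pi zero    zero    = Pi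
insertAt-preserves P Pf Pi zero    (suc x) = Pf x
insertAt-preserves {m = suc m} P Pf Pi (suc v) zero    = Pf zero
insertAt-preserves {m = suc m} P Pf Pi (suc v) (suc x) = insertAt-preserves P (Pf ∘ suc) Pi v x

∑-choices-suc : (h : (Fin (suc m) → Fin n) → ℕ) → Extensional h →
                ∑ (choices (suc m) n) h ≡ ∑[ i ∈ allFin n ] ∑[ f ∈ choices m n ] h (insertAt f zero i)
∑-choices-suc {m} {n} h h-ext =
  -- The extension of f by i used in choices agrees pointwise with insertAt f zero i.
  trans (∑-concatMap _ h (allFin n))
        (∑-cong (λ i → trans (∑-map _ h (choices m n))
                             (∑-cong (λ f → h-ext λ { zero → refl ; (suc x) → refl }) (choices m n)))
                (allFin n))

∑-choices-insertAt : (v : Fin (suc m)) (h : (Fin (suc m) → Fin n) → ℕ) → Extensional h →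
                     ∑ (choices (suc m) n) h ≡ ∑[ f ∈ choices m n ] ∑[ i ∈ allFin n ] h (insertAt f v i)
∑-choices-insertAt {m} {n} zero h h-ext =
  trans (∑-choices-suc h h-ext) (∑-comm (λ i f → h (insertAt f zero i)) (allFin n) (choices m n))
∑-choices-insertAt {suc m} {n} (suc v) h h-ext = begin
  ∑ (choices (suc (suc m)) n) h
    ≡⟨ ∑-choices-suc h h-ext ⟩
  ∑[ j ∈ allFin n ] ∑[ g ∈ choices (suc m) n ] h (insertAt g zero j)
    ≡⟨ ∑-cong (λ j → ∑-choices-insertAt v _ (h-ext ∘ insertAt-cong zero j)) (allFin n) ⟩
  ∑[ j ∈ allFin n ] ∑[ g ∈ choices m n ] ∑[ i ∈ allFin n ] h (insertAt (insertAt g v i) zero j)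
    ≡⟨ ∑-cong (λ j → ∑-cong (λ g → ∑-cong (λ i → h-ext (insertAt-swap g i j)) (allFin n))
                            (choices m n)) (allFin n) ⟩
  ∑[ j ∈ allFin n ] ∑[ g ∈ choices m n ] ∑[ i ∈ allFin n ] h (insertAt (insertAt g zero j) (suc v) i)
    ≡⟨ ∑-choices-suc (λ f → ∑[ i ∈ allFin n ] h (insertAt f (suc v) i))
                     (λ f≗g → ∑-cong (λ i → h-ext (insertAt-cong (suc v) i f≗g)) (allFin n)) ⟨
  ∑[ f ∈ choices (suc m) n ] ∑[ i ∈ allFin n ] h (insertAt f (suc v) i) ∎
  where
  open ≡-Reasoning
  insertAt-swap : (g : Fin m → Fin n) (i j : Fin n) →
                  insertAt (insertAt g v i) zero j ≗ insertAt (insertAt g zero j) (suc v) i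
  insertAt-swap g i j zero    = refl
  insertAt-swap g i j (suc x) = refl

-- Proper colourings and leaves

T-all⁻ : (p : A → Bool) (xs : List A) → T (all p xs) → ∀ {x} → x ∈ xs → T (p x)
T-all⁻ p (y ∷ xs) t (here refl) = proj₁ (Equivalence.to T-∧ t)
T-all⁻ p (y ∷ xs) t (there x∈)  = T-all⁻ p xs (proj₂ (Equivalence.to T-∧ t)) x∈

T-all⁺ : (p : A → Bool) (xs : List A) → (∀ x → T (p x)) → T (all p xs)
T-all⁺ p []       all-p = tt
T-all⁺ p (x ∷ xs) all-p = Equivalence.from T-∧ (all-p x , T-all⁺ p xs all-p)

T-injective : {b c : Bool} → (T b → T c) → (T c → T b) → b ≡ c
T-injective {false} {false} _   _   = refl
T-injective {false} {true}  _   c⇒b = ⊥-elim (c⇒b tt)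
T-injective {true}  {false} b⇒c _   = ⊥-elim (b⇒c tt)
T-injective {true}  {true}  _   _   = refl

Proper : Graph m → (Fin m → ℕ) → Set
Proper G c = ∀ {a b} → T (adj G a b) → c a ≢ c b

properB⇒Proper : (G : Graph m) (c : Fin m → ℕ) → T (properB G c) → Proper G c
properB⇒Proper G c t {a} {b} ab with adj G a b | T-all⁻ _ _ (T-all⁻ _ _ t (∈-allFin a)) (∈-allFin b)
... | true | ca≢cb = T-not-≡ᵇ ca≢cb

Proper⇒properB : (G : Graph m) (c : Fin m → ℕ) → Proper G c → T (properB G c)
Proper⇒properB {m} G c proper =
  T-all⁺ _ (allFin m) λ a → T-all⁺ _ (allFin m) λ b → edge-ok a b proper
  where
  edge-ok : ∀ a b → (T (adj G a b) → c a ≢ c b) → T (not (adj G a b) ∨ not (c a ≡ᵇ c b))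
  edge-ok a b ok with adj G a b
  ... | false = tt
  ... | true  = ≢⇒T-not-≡ᵇ (ok tt)

properB-cong : (G : Graph m) {c c′ : Fin m → ℕ} → c ≗ c′ → properB G c ≡ properB G c′
properB-cong G {c} {c′} c≗c′ = T-injective
  (λ t → Proper⇒properB G c′ λ ab e → properB⇒Proper G c t ab (trans (c≗c′ _) (trans e (sym (c≗c′ _)))))
  (λ t → Proper⇒properB G c λ ab e → properB⇒Proper G c′ t ab (trans (sym (c≗c′ _)) (trans e (c≗c′ _))))

data DeleteView (v : Fin (suc m)) : Fin (suc m) → Set where
  deleted : DeleteView v v
  kept    : (a : Fin m) → DeleteView v (punchIn v a)

deleteView : (v a : Fin (suc m)) → DeleteView v a
deleteView v a with v ≟ a
... | yes refl = deleted
... | no v≢a   = subst (DeleteView v) (Fin.punchIn-punchOut v≢a) (kept (punchOut v≢a))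

record Leaf (G : Graph (suc m)) (v : Fin (suc m)) : Set where
  field
    neighbour : Fin m
    adjacent  : T (adj G v (punchIn v neighbour))
    unique    : ∀ {w} → T (adj G v w) → w ≡ punchIn v neighbour

degree≡1⇒Leaf : (G : Graph (suc m)) (v : Fin (suc m)) → degree G v ≡ 1 → Leaf G v
degree≡1⇒Leaf G v d with ∑𝟙≡1⇒unique (adj G v) (allFin _) d
... | w , vw , unique with deleteView v w
...   | deleted = ⊥-elim (subst T (irrefl G v) vw)
...   | kept w′ = record { neighbour = w′ ; adjacent = vw ; unique = unique (∈-allFin _) }

module _ {G : Graph (suc m)} {v : Fin (suc m)} (leaf : Leaf G v) where
  open Leaf leaf

  private
    u : Fin (suc m)
    u = punchIn v neighbour

  Proper-deleteLeaf⁺ : {γ : Fin (suc m) → ℕ} →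
                       Proper G γ → Proper (deleteVertex G v) (γ ∘ punchIn v) × γ v ≢ γ u
  Proper-deleteLeaf⁺ proper = proper , proper adjacent

  Proper-deleteLeaf⁻ : {γ : Fin (suc m) → ℕ} →
                       Proper (deleteVertex G v) (γ ∘ punchIn v) → γ v ≢ γ u → Proper G γ
  Proper-deleteLeaf⁻ {γ} proper γv≢γu {a} {b} ab with deleteView v a | deleteView v b
  ... | deleted | _       = λ e → γv≢γu (trans e (cong γ (unique ab)))
  ... | kept a′ | deleted = λ e → γv≢γu (trans (sym e) (cong γ (unique (subst T (adj-sym G _ v) ab))))
  ... | kept a′ | kept b′ = proper ab

  properB-deleteLeaf : (γ : Fin (suc m) → ℕ) →
                       properB G γ ≡ properB (deleteVertex G v) (γ ∘ punchIn v) ∧ not (γ v ≡ᵇ γ u)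
  properB-deleteLeaf γ = T-injective to from
    where
    G-v = deleteVertex G v
    to : T (properB G γ) → T (properB G-v (γ ∘ punchIn v) ∧ not (γ v ≡ᵇ γ u))
    to t = let proper , γv≢γu = Proper-deleteLeaf⁺ (properB⇒Proper G γ t) in
           Equivalence.from T-∧ (Proper⇒properB G-v (γ ∘ punchIn v) proper , ≢⇒T-not-≡ᵇ γv≢γu)
    from : T (properB G-v (γ ∘ punchIn v) ∧ not (γ v ≡ᵇ γ u)) → T (properB G γ)
    from t = let t-away , t-leaf = Equivalence.to T-∧ t in
             Proper⇒properB G γ (Proper-deleteLeaf⁻ (properB⇒Proper G-v (γ ∘ punchIn v) t-away)
                                                    (T-not-≡ᵇ t-leaf))

-- Deleting a leaf

col≡∑ : (G : Graph m) (L : ListAssignment m n) →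
        col G L ≡ ∑[ f ∈ choices m n ] 𝟙 (properB G (λ x → L x (f x)))
col≡∑ {m} {n} G L = length-filterᵇ _ (choices m n)

col-cong : (G : Graph m) {L L′ : ListAssignment m n} → (∀ x → L x ≡ L′ x) → col G L ≡ col G L′
col-cong {m} {n} G {L} {L′} L≡L′ = begin
  col G L                                                 ≡⟨ col≡∑ G L ⟩
  ∑[ f ∈ choices m n ] 𝟙 (properB G (λ x → L x (f x)))   ≡⟨ ∑-cong (cong 𝟙 ∘ properB-cong G ∘ L≗L′) (choices m n) ⟩
  ∑[ f ∈ choices m n ] 𝟙 (properB G (λ x → L′ x (f x)))  ≡⟨ col≡∑ G L′ ⟨
  col G L′                                                ∎
  where
  open ≡-Reasoning
  L≗L′ : (f : Fin m → Fin n) (x : Fin m) → L x (f x) ≡ L′ x (f x)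
  L≗L′ f x = cong (λ ℓ → ℓ (f x)) (L≡L′ x)

module _ {G : Graph (suc m)} {v : Fin (suc m)} (leaf : Leaf G v) (L : ListAssignment (suc m) n) where
  open Leaf leaf

  properAway : (Fin m → Fin n) → Bool
  properAway f = properB (deleteVertex G v) (λ y → L (punchIn v y) (f y))

  neighbourColour : (Fin m → Fin n) → ℕ
  neighbourColour f = L (punchIn v neighbour) (f neighbour)

  col-deleteLeaf : col G L ≡ ∑[ f ∈ choices m n ] 𝟙 (properAway f) * count≢ (L v) (neighbourColour f)
  col-deleteLeaf = begin
    col G L
      ≡⟨ col≡∑ G L ⟩
    ∑[ F ∈ choices (suc m) n ] 𝟙 (properB G (λ x → L x (F x)))
      ≡⟨ ∑-choices-insertAt v _ (λ F≗F′ → cong 𝟙 (properB-cong G (cong (L _) ∘ F≗F′))) ⟩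
    ∑[ f ∈ choices m n ] ∑[ i ∈ allFin n ] 𝟙 (properB G (λ x → L x (insertAt f v i x)))
      ≡⟨ ∑-cong (λ f → ∑-cong (cong 𝟙 ∘ properB-insertAt f) (allFin n)) (choices m n) ⟩
    ∑[ f ∈ choices m n ] ∑[ i ∈ allFin n ] 𝟙 (properAway f ∧ not (L v i ≡ᵇ neighbourColour f))
      ≡⟨ ∑-cong (λ f → ∑-𝟙-∧ (properAway f) _ (allFin n)) (choices m n) ⟩
    ∑[ f ∈ choices m n ] 𝟙 (properAway f) * count≢ (L v) (neighbourColour f) ∎
    where
    open ≡-Reasoning
    properB-insertAt : (f : Fin m → Fin n) (i : Fin n) →
                       properB G (λ x → L x (insertAt f v i x)) ≡ properAway f ∧ not (L v i ≡ᵇ neighbourColour f)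
    properB-insertAt f i = trans (properB-deleteLeaf leaf (λ x → L x (insertAt f v i x)))
      (cong₂ _∧_
        (properB-cong (deleteVertex G v) (λ y → cong (L (punchIn v y)) (insertAt-punchIn f v i y)))
        (cong not (cong₂ _≡ᵇ_ (cong (L v) (insertAt-lookup f v i))
                              (cong (L (punchIn v neighbour)) (insertAt-punchIn f v i neighbour)))))

module _ {G : Graph (suc m)} {v : Fin (suc m)} (leaf : Leaf G v) (L : ListAssignment (suc m) (suc n)) where
  open Leaf leaf

  private
    properAway′ = properAway leaf L
    neighbourColour′ = neighbourColour leaf L

  col-deleteLeaf-≥ : Injective (L v) → col (deleteVertex G v) (removeAt L v) * n ≤ col G L
  col-deleteLeaf-≥ inj = begin
    col (deleteVertex G v) (removeAt L v) * n
      ≡⟨ cong (_* n) (col≡∑ (deleteVertex G v) (removeAt L v)) ⟩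
    (∑[ f ∈ choices m (suc n) ] 𝟙 (properAway′ f)) * n
      ≡⟨ ∑-*ʳ (𝟙 ∘ properAway′) n (choices m (suc n)) ⟨
    ∑[ f ∈ choices m (suc n) ] 𝟙 (properAway′ f) * n
      ≤⟨ ∑-mono (λ f → *-monoʳ-≤ (𝟙 (properAway′ f)) (count≢-≥ (L v) inj (neighbourColour′ f)))
                (choices m (suc n)) ⟩
    ∑[ f ∈ choices m (suc n) ] 𝟙 (properAway′ f) * count≢ (L v) (neighbourColour′ f)
      ≡⟨ col-deleteLeaf leaf L ⟨
    col G L ∎
    where open ℕ.≤-Reasoning

  col-deleteLeaf-≡ : L v ≡ L (punchIn v neighbour) → Injective (L v) →
                     col G L ≡ col (deleteVertex G v) (removeAt L v) * n
  col-deleteLeaf-≡ Lv≡Lu inj = begin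
    col G L
      ≡⟨ col-deleteLeaf leaf L ⟩
    ∑[ f ∈ choices m (suc n) ] 𝟙 (properAway′ f) * count≢ (L v) (neighbourColour′ f)
      ≡⟨ ∑-cong (λ f → cong (𝟙 (properAway′ f) *_) (count≢-neighbour f)) (choices m (suc n)) ⟩
    ∑[ f ∈ choices m (suc n) ] 𝟙 (properAway′ f) * n
      ≡⟨ ∑-*ʳ (𝟙 ∘ properAway′) n (choices m (suc n)) ⟩
    (∑[ f ∈ choices m (suc n) ] 𝟙 (properAway′ f)) * n
      ≡⟨ cong (_* n) (col≡∑ (deleteVertex G v) (removeAt L v)) ⟨
    col (deleteVertex G v) (removeAt L v) * n ∎
    where
    open ≡-Reasoning
    count≢-neighbour : (f : Fin m → Fin (suc n)) → count≢ (L v) (neighbourColour′ f) ≡ n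
    count≢-neighbour f = subst (λ a → count≢ (L v) (a (f neighbour)) ≡ n) Lv≡Lu
                               (count≢-image (L v) inj (f neighbour))

standard-injective : (n : ℕ) (x : Fin m) → Injective (standard {m} n x)
standard-injective n x i j e = Fin.toℕ-injective (ℕ.suc-injective e)

monophilic-deleteLeaf : {k : ℕ} {G : Graph (suc m)} {v : Fin (suc m)} → Leaf G v →
                        Monophilic (suc (suc k)) G ⇔ Monophilic (suc (suc k)) (deleteVertex G v)
monophilic-deleteLeaf {m} {k} {G} {v} leaf = mk⇔ to from
  where
  open Leaf leaf
  2+k = suc (suc k)
  G-v = deleteVertex G v

  colN-deleteLeaf : colN G 2+k ≡ colN G-v 2+k * suc k
  colN-deleteLeaf = col-deleteLeaf-≡ leaf (standard 2+k) refl (standard-injective 2+k v)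

  from : Monophilic 2+k G-v → Monophilic 2+k G
  from mono L L-inj = begin
    colN G 2+k                     ≡⟨ colN-deleteLeaf ⟩
    colN G-v 2+k * suc k           ≤⟨ ℕ.*-monoˡ-≤ (suc k) (mono (removeAt L v) (L-inj ∘ punchIn v)) ⟩
    col G-v (removeAt L v) * suc k ≤⟨ col-deleteLeaf-≥ leaf L (L-inj v) ⟩
    col G L                        ∎
    where open ℕ.≤-Reasoning

  to : Monophilic 2+k G → Monophilic 2+k G-v
  to mono L L-inj = *-cancelʳ-≤ _ _ (suc k) (begin
    colN G-v 2+k * suc k            ≡⟨ colN-deleteLeaf ⟨
    colN G 2+k                      ≤⟨ mono L⁺ L⁺-inj ⟩
    col G L⁺                        ≡⟨ col-deleteLeaf-≡ leaf L⁺ L⁺v≡L⁺u (L⁺-inj v) ⟩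
    col G-v (removeAt L⁺ v) * suc k ≡⟨ cong (_* suc k) (col-cong G-v (removeAt-insertAt L v (L neighbour))) ⟩
    col G-v L * suc k               ∎)
    where
    open ℕ.≤-Reasoning
    L⁺ : ListAssignment (suc m) 2+k
    L⁺ = insertAt L v (L neighbour)
    L⁺-inj : IsListAssignment L⁺
    L⁺-inj = insertAt-preserves Injective L-inj (L-inj neighbour) v
    L⁺v≡L⁺u : L⁺ v ≡ L⁺ (punchIn v neighbour)
    L⁺v≡L⁺u = trans (insertAt-lookup L v _) (sym (insertAt-punchIn L v _ neighbour))

monophilic-leafReduces : {k m′ : ℕ} {G : Graph m} {H : Graph m′} → LeafReduces G H →
                         Monophilic (suc (suc k)) G ⇔ Monophilic (suc (suc k)) H
monophilic-leafReduces done                          = ⇔-id _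
monophilic-leafReduces {k = k} (del {G = G} v d red) =
  monophilic-leafReduces red ⇔-∘ monophilic-deleteLeaf {k = k} (degree≡1⇒Leaf G v d)

monophilic-1 : (G : Graph m) → Monophilic 1 G
monophilic-1 {m} G L _ = begin
  colN G 1                                             ≡⟨ col≡∑ G (standard 1) ⟩
  ∑[ f ∈ choices m 1 ] 𝟙 (properB G (std ∘ f))         ≤⟨ ∑-mono (λ f → 𝟙-mono (edgeless⇒proper f)) (choices m 1) ⟩
  ∑[ f ∈ choices m 1 ] 𝟙 (properB G (λ x → L x (f x))) ≡⟨ col≡∑ G L ⟨
  col G L                                              ∎
  where
  open ℕ.≤-Reasoning
  std : Fin 1 → ℕ
  std i = suc (toℕ i)
  one-colour : (i j : Fin 1) → i ≡ j
  one-colour zero zero = refl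
  edgeless⇒proper : (f : Fin m → Fin 1) → T (properB G (std ∘ f)) → T (properB G (λ x → L x (f x)))
  edgeless⇒proper f t = Proper⇒properB G (λ x → L x (f x)) λ {a} {b} ab →
    ⊥-elim (properB⇒Proper G (std ∘ f) t ab (cong std (one-colour (f a) (f b))))

mainTheorem6 : (n : ℕ) → 1 ≤ n → ∀ {m k} (G : Graph m) (H : Graph k) →
                 Connected G → IsCoreOf H G → (Monophilic n G ⇔ Monophilic n H)
mainTheorem6 (suc zero)    _ G H _ _         = mk⇔ (λ _ → monophilic-1 H) (λ _ → monophilic-1 G)
mainTheorem6 (suc (suc k)) _ G H _ (red , _) = monophilic-leafReduces red
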